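{- Let $G$ be a connected graph with a cut-vertex $c$ such that $G-c$ has $\ell\geq 3$ connected components $H_1,\dots,H_\ell$, ordered so that $\operatorname{ZIR}(H_1)\geq\cdots\geq\operatorname{ZIR}(H_\ell)$. For $i=1,\dots,\ell$ let $S_i$ be a ZIr-set of $H_i$. Then for each $k=1,\dots,\ell$, the set $\bigcup_{i\neq k}S_i$ is a ZIr-set of $G$, and $\operatorname{ZIR}(G)\geq \operatorname{ZIR}(H_1)+\cdots+\operatorname{ZIR}(H_{\ell-1})$. This bound is sharp (equality holds for some such graph).
   Context: A fort of a graph is a nonempty vertex subset $F$ such that every vertex $v\notin F$ has $|F\cap N(v)|\neq 1$. For a vertex set $S$ and $x\in S$, a private fort of $x$ relative to $S$ is a fort $F$ with $S\cap F=\{x\}$; $S$ is a ZIr-set if every element has a private fort. $\operatorname{ZIR}(G)$ is the maximum cardinality of an inclusion-maximal ZIr-set of $G$. -}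

module Defs where

open import Data.Bool using (Bool; true; false)
open import Data.Nat using (ℕ; suc; _≤_)
open import Data.Fin using (Fin)
open import Data.Fin.Subset using (Subset; _∈_; _∉_; _⊆_; _∩_; ∣_∣; ⁅_⁆; Nonempty)
open import Data.Vec using (tabulate)
open import Data.Product using (Σ; ∃; _×_)
open import Relation.Binary.PropositionalEquality using (_≡_; _≢_)

record Graph (n : ℕ) : Set where
  field
    adj    : Fin n → Fin n → Bool
    sym    : ∀ u v → adj u v ≡ adj v u
    irrefl : ∀ v → adj v v ≡ false
open Graph public

N : ∀ {n} → Graph n → Fin n → Subset n
N G v = tabulate (adj G v)

-- All notions below are taken in the induced subgraph G[U].
-- (For F ⊆ U, F ∩ N_G(v) = F ∩ N_{G[U]}(v).)

FortIn : ∀ {n} → Graph n → Subset n → Subset n → Set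
FortIn G U F =
  F ⊆ U × Nonempty F ×
  (∀ v → v ∈ U → v ∉ F → ∣ F ∩ N G v ∣ ≢ 1)

ZIrIn : ∀ {n} → Graph n → Subset n → Subset n → Set
ZIrIn G U S =
  S ⊆ U ×
  (∀ x → x ∈ S → ∃ λ F → FortIn G U F × (S ∩ F) ≡ ⁅ x ⁆)

MaxZIrIn : ∀ {n} → Graph n → Subset n → Subset n → Set
MaxZIrIn G U S = ZIrIn G U S × (∀ T → ZIrIn G U T → S ⊆ T → T ⊆ S)

IsZIRIn : ∀ {n} → Graph n → Subset n → ℕ → Set
IsZIRIn G U m =
  (∃ λ S → MaxZIrIn G U S × ∣ S ∣ ≡ m) ×
  (∀ S → MaxZIrIn G U S → ∣ S ∣ ≤ m)

data Reach {n} (G : Graph n) (U : Subset n) : Fin n → Fin n → Set where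
  here : ∀ {u} → u ∈ U → Reach G U u u
  step : ∀ {u w v} → u ∈ U → adj G u w ≡ true → Reach G U w v → Reach G U u v

ConnectedIn : ∀ {n} → Graph n → Subset n → Set
ConnectedIn G U = ∀ u v → u ∈ U → v ∈ U → Reach G U u v

record Components {n ℓ : ℕ} (G : Graph n) (c : Fin n) (C : Fin ℓ → Subset n) : Set where
  field
    avoid     : ∀ i → c ∉ C i
    cover     : ∀ v → v ≢ c → ∃ λ i → v ∈ C i
    disjoint  : ∀ i j v → v ∈ C i → v ∈ C j → i ≡ j
    nonempty  : ∀ i → Nonempty (C i)
    connected : ∀ i → ConnectedIn G (C i)
    noEdges   : ∀ i j u v → u ∈ C i → v ∈ C j → adj G u v ≡ true → i ≡ j

{-# OPTIONS --safe #-}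
module Submission where

-- A private fort F of x in its component C i is already a fort of G unless the cut vertex c sees
-- exactly one vertex of F.  In that case F ∪ C j is a fort of G: c has a neighbour in every
-- component (G is connected), so it now sees at least two vertices, and C j misses every S i with
-- i ≢ j.  Extending the union of maximum ZIr-sets of all components but the last to a maximal
-- ZIr-set of G gives the lower bound.
-- Equality holds for the star K₁,₃, whose leaves have ZIR 1: a ZIr-set containing the centre is just
-- the centre, and the set of all leaves is not a ZIr-set, so ZIR(K₁,₃) = 2.

open import Defs hiding (sym)
open import Data.Bool using (Bool; true; false)
open import Data.Fin using (Fin; zero; suc; inject₁; fromℕ; toℕ; lower₁; _≟_) renaming (_≤_ to _≤ᶠ_)
open import Data.Fin.Properties as Fin
  using (toℕ-injective; toℕ-fromℕ; fromℕ≢inject₁; inject₁-lower₁; inject₁-injective; 0≢1+n)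
open import Data.Fin.Subset using (Subset; _∈_; _∉_; _⊆_; _∩_; _∪_; ∣_∣; ⁅_⁆; ⋃; Nonempty; Empty; ⊤; ⊥; inside; outside)
open import Data.Fin.Subset.Properties
  using (_∈?_; ∈⊤; ⊆⊤; ∉⊥; ⊆-refl; ⊆-trans; ⊆-antisym; Empty-unique; drop-∷-Empty;
         x∈⁅x⁆; x∈⁅y⁆⇒x≡y; x∈⁅y⁆⇔x≡y; x∈p∩q⁺; x∈p∩q⁻; p∩q⊆p; p∩q⊆q; x∈p∪q⁺; x∈p∪q⁻;
         ∩-idem; ∩-identityˡ; ∩-identityʳ; ∩-distribˡ-∪; ∩-distribʳ-∪; ∪-identityʳ;
         ∣⊥∣≡0; ∣⊤∣≡n; ∣⁅x⁆∣≡1; ∣p∣≤n; ∣p∣≤∣x∷p∣; ∣p∣≡n⇒p≡⊤; p⊆q⇒∣p∣≤∣q∣; p⊂q⇒∣p∣<∣q∣)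
open import Data.List using (map; allFin; tabulate)
open import Data.List.Properties using (map-tabulate; tabulate-cong)
open import Data.Nat using (ℕ; zero; suc; _+_; _∸_; _≤_; _<_; s≤s; z≤n; _≤?_)
import Data.Nat as ℕ
open import Data.Nat.Induction using (<-wellFounded)
open import Data.Nat.ListAction using (sum)
open import Data.Nat.Properties
  using (≤-refl; ≤-trans; <-≤-trans; <⇒≱; <⇒≢; ≰⇒>; ≤∧≢⇒<; ≤-pred; ∸-monoʳ-<; suc-injective; +-suc; +-identityʳ)
open import Data.Product using (Σ; ∃; ∃₂; _×_; _,_; proj₁; proj₂)
open import Data.Sum using (inj₁; inj₂)
open import Data.Vec using ([]; _∷_; here; there)
open import Data.Vec.Properties using ([]=⇒lookup; lookup⇒[]=; lookup∘tabulate)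
open import Function using (_∘_; id)
open import Function.Bundles using (_⇔_; mk⇔; Equivalence)
open import Induction.WellFounded using (module All)
open import Level using (0ℓ)
import Relation.Binary.Construct.On as On
open import Relation.Binary.PropositionalEquality using (_≡_; _≢_; refl; sym; trans; cong; subst; module ≡-Reasoning)
open import Relation.Nullary using (¬_; yes; no; contradiction)
open import Relation.Nullary.Decidable using (decidable-stable)

open ≡-Reasoning

∈N⇒adj : ∀ {n} (G : Graph n) v {w} → w ∈ N G v → adj G v w ≡ true
∈N⇒adj G v {w} w∈N = trans (sym (lookup∘tabulate (adj G v) w)) ([]=⇒lookup w∈N)

adj⇒∈N : ∀ {n} (G : Graph n) v {w} → adj G v w ≡ true → w ∈ N G v
adj⇒∈N G v {w} vw = lookup⇒[]= w (N G v) (trans (lookup∘tabulate (adj G v) w) vw)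

Empty⇒∣p∣≡0 : ∀ {n} {p : Subset n} → Empty p → ∣ p ∣ ≡ 0
Empty⇒∣p∣≡0 {n} p-empty = trans (cong ∣_∣ (Empty-unique p-empty)) (∣⊥∣≡0 n)

x∈p⇒0<∣p∣ : ∀ {n} {p : Subset n} {x} → x ∈ p → 0 < ∣ p ∣
x∈p⇒0<∣p∣ here                    = s≤s z≤n
x∈p⇒0<∣p∣ {p = s ∷ p} (there x∈p) = <-≤-trans (x∈p⇒0<∣p∣ x∈p) (∣p∣≤∣x∷p∣ s p)

∣p∪q∣≡∣p∣+∣q∣ : ∀ {n} (p q : Subset n) → Empty (p ∩ q) → ∣ p ∪ q ∣ ≡ ∣ p ∣ + ∣ q ∣
∣p∪q∣≡∣p∣+∣q∣ []            []            _ = refl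
∣p∪q∣≡∣p∣+∣q∣ (inside  ∷ p) (inside  ∷ q) e = contradiction (zero , here) e
∣p∪q∣≡∣p∣+∣q∣ (inside  ∷ p) (outside ∷ q) e = cong suc (∣p∪q∣≡∣p∣+∣q∣ p q (drop-∷-Empty e))
∣p∪q∣≡∣p∣+∣q∣ (outside ∷ p) (inside  ∷ q) e =
  trans (cong suc (∣p∪q∣≡∣p∣+∣q∣ p q (drop-∷-Empty e))) (sym (+-suc ∣ p ∣ ∣ q ∣))
∣p∪q∣≡∣p∣+∣q∣ (outside ∷ p) (outside ∷ q) e = ∣p∪q∣≡∣p∣+∣q∣ p q (drop-∷-Empty e)

p⊆q⇒∣q∣≤∣p∣⇒q⊆p : ∀ {n} {p q : Subset n} → p ⊆ q → ∣ q ∣ ≤ ∣ p ∣ → q ⊆ p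
p⊆q⇒∣q∣≤∣p∣⇒q⊆p {p = p} p⊆q ∣q∣≤∣p∣ {x} x∈q =
  decidable-stable (x ∈? p) λ x∉p → <⇒≱ (p⊂q⇒∣p∣<∣q∣ (p⊆q , x , x∈q , x∉p)) ∣q∣≤∣p∣

x∈⋃tabulate⁻ : ∀ {k n} (f : Fin k → Subset n) {x} → x ∈ ⋃ (tabulate f) → ∃ λ i → x ∈ f i
x∈⋃tabulate⁻ {zero}  f x∈⋃ = contradiction x∈⋃ ∉⊥
x∈⋃tabulate⁻ {suc k} f x∈⋃ with x∈p∪q⁻ (f zero) (⋃ (tabulate (f ∘ suc))) x∈⋃
... | inj₁ x∈f₀ = zero , x∈f₀
... | inj₂ x∈⋃′ = let i , x∈fᵢ = x∈⋃tabulate⁻ (f ∘ suc) x∈⋃′ in suc i , x∈fᵢ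

x∈⋃tabulate⁺ : ∀ {k n} (f : Fin k → Subset n) i {x} → x ∈ f i → x ∈ ⋃ (tabulate f)
x∈⋃tabulate⁺ f zero    x∈f = x∈p∪q⁺ (inj₁ x∈f)
x∈⋃tabulate⁺ f (suc i) x∈f = x∈p∪q⁺ (inj₂ (x∈⋃tabulate⁺ (f ∘ suc) i x∈f))

∣⋃tabulate∣≡sum : ∀ {k n} (f : Fin k → Subset n) → (∀ i j {x} → x ∈ f i → x ∈ f j → i ≡ j) →
                  ∣ ⋃ (tabulate f) ∣ ≡ sum (tabulate (∣_∣ ∘ f))
∣⋃tabulate∣≡sum {zero}  {n} f _ = ∣⊥∣≡0 n
∣⋃tabulate∣≡sum {suc k}     f disjoint =
  trans (∣p∪q∣≡∣p∣+∣q∣ (f zero) (⋃ (tabulate (f ∘ suc))) head-disjoint)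
        (cong (∣ f zero ∣ +_) (∣⋃tabulate∣≡sum (f ∘ suc) λ i j x∈fᵢ x∈fⱼ →
          Fin.suc-injective (disjoint (suc i) (suc j) x∈fᵢ x∈fⱼ)))
  where
  head-disjoint : Empty (f zero ∩ ⋃ (tabulate (f ∘ suc)))
  head-disjoint (x , x∈∩) with x∈p∩q⁻ (f zero) _ x∈∩
  ... | x∈f₀ , x∈⋃ with x∈⋃tabulate⁻ (f ∘ suc) x∈⋃
  ...   | i , x∈fᵢ = 0≢1+n (disjoint zero (suc i) x∈f₀ x∈fᵢ)

Maximal : ∀ {n} → (Subset n → Set) → Subset n → Set
Maximal P S = P S × (∀ T → P T → S ⊆ T → T ⊆ S)

-- Assuming T has no maximal extension, T is itself maximal: a strictly larger U with P U would
-- have one by induction on n ∸ ∣ U ∣, and it would extend T.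
extend-to-maximal : ∀ {n} (P : Subset n → Set) T → P T → ¬ ¬ (∃ λ S → Maximal P S × T ⊆ S)
extend-to-maximal {n} P = All.wfRec (On.wellFounded (λ T → n ∸ ∣ T ∣) <-wellFounded) 0ℓ _ extend
  where
  extend : ∀ T → (∀ {U} → n ∸ ∣ U ∣ < n ∸ ∣ T ∣ → P U → ¬ ¬ (∃ λ S → Maximal P S × U ⊆ S)) →
           P T → ¬ ¬ (∃ λ S → Maximal P S × T ⊆ S)
  extend T larger PT no-extension = no-extension (T , (PT , T-maximal) , ⊆-refl)
    where
    T-maximal : ∀ U → P U → T ⊆ U → U ⊆ T
    T-maximal U PU T⊆U = p⊆q⇒∣q∣≤∣p∣⇒q⊆p T⊆U (decidable-stable (∣ U ∣ ≤? ∣ T ∣) λ ∣U∣≰∣T∣ →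
      larger (∸-monoʳ-< (≰⇒> ∣U∣≰∣T∣) (∣p∣≤n U)) PU λ (S , S-maximal , U⊆S) →
        no-extension (S , S-maximal , ⊆-trans T⊆U U⊆S))

-- Extension to a maximal ZIr-set is only available under ¬ ¬, which suffices since ≤ is decidable.
∣ZIr∣≤ZIR : ∀ {n} {G : Graph n} {U T : Subset n} {m} → ZIrIn G U T → IsZIRIn G U m → ∣ T ∣ ≤ m
∣ZIr∣≤ZIR {G = G} {U} {T} {m} T-ZIr (_ , maximal-bound) =
  decidable-stable (∣ T ∣ ≤? m) λ ∣T∣≰m →
    extend-to-maximal (ZIrIn G U) T T-ZIr λ (S , S-maximal , T⊆S) →
      ∣T∣≰m (≤-trans (p⊆q⇒∣p∣≤∣q∣ T⊆S) (maximal-bound S S-maximal))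

walk-enters : ∀ {n} {G : Graph n} {U X : Subset n} {u v} → Reach G U u v → u ∉ X → v ∈ X →
              ∃₂ λ a b → a ∉ X × b ∈ X × adj G a b ≡ true
walk-enters (here _) u∉X u∈X = contradiction u∈X u∉X
walk-enters {X = X} (step {u} {w} _ uw walk) u∉X v∈X with w ∈? X
... | yes w∈X = u , w , u∉X , w∈X , uw
... | no  w∉X = walk-enters walk w∉X v∈X

module CutVertex {n ℓ} {G : Graph n} {c : Fin n} {C : Fin ℓ → Subset n}
                 (G-connected : ConnectedIn G ⊤) (components : Components G c C) where
  open Components components hiding (connected)

  ∣∩N∣≡0-across : ∀ {i m F v} → F ⊆ C i → v ∈ C m → m ≢ i → ∣ F ∩ N G v ∣ ≡ 0
  ∣∩N∣≡0-across {i} {m} {F} {v} F⊆Cᵢ v∈Cₘ m≢i = Empty⇒∣p∣≡0 λ (w , w∈F∩N) →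
    let w∈F , w∈N = x∈p∩q⁻ F (N G v) w∈F∩N in
    m≢i (noEdges m i v w v∈Cₘ (F⊆Cᵢ w∈F) (∈N⇒adj G v w∈N))

  fort-condition-off-cut : ∀ {i F} → FortIn G (C i) F → ∀ {v} → v ≢ c → v ∉ F → ∣ F ∩ N G v ∣ ≢ 1
  fort-condition-off-cut {i} (F⊆Cᵢ , _ , fort) {v} v≢c v∉F with cover v v≢c
  ... | m , v∈Cₘ with m ≟ i
  ...   | yes refl = fort v v∈Cₘ v∉F
  ...   | no  m≢i  = subst (_≢ 1) (sym (∣∩N∣≡0-across F⊆Cᵢ v∈Cₘ m≢i)) λ ()

  -- A walk from c into C j enters it along an edge ab; a ≠ c is impossible, as then a would lie
  -- in a component joined to C j by an edge.
  cut-sees-component : ∀ j → 0 < ∣ C j ∩ N G c ∣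
  cut-sees-component j with nonempty j
  ... | v , v∈Cⱼ with walk-enters (G-connected c v ∈⊤ ∈⊤) (avoid j) v∈Cⱼ
  ...   | a , b , a∉Cⱼ , b∈Cⱼ , ab with a ≟ c
  ...     | yes refl = x∈p⇒0<∣p∣ (x∈p∩q⁺ (b∈Cⱼ , adj⇒∈N G c ab))
  ...     | no  a≢c  = let m , a∈Cₘ = cover a a≢c in
                       contradiction (subst (λ m → a ∈ C m) (noEdges m j a b a∈Cₘ b∈Cⱼ ab) a∈Cₘ) a∉Cⱼ

  fort-lift : ∀ {i F} → FortIn G (C i) F → ∣ F ∩ N G c ∣ ≢ 1 → FortIn G ⊤ F
  fort-lift {F = F} F-fort@(_ , F-nonempty , _) at-cut = ⊆⊤ , F-nonempty , condition
    where
    condition : ∀ v → v ∈ ⊤ → v ∉ F → ∣ F ∩ N G v ∣ ≢ 1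
    condition v _ v∉F with v ≟ c
    ... | yes refl = at-cut
    ... | no  v≢c  = fort-condition-off-cut F-fort v≢c v∉F

  ∣[F∪Cⱼ]∩N∣≡∣F∩N∣+∣Cⱼ∩N∣ : ∀ {i j F} → F ⊆ C i → i ≢ j → ∀ v →
                 ∣ (F ∪ C j) ∩ N G v ∣ ≡ ∣ F ∩ N G v ∣ + ∣ C j ∩ N G v ∣
  ∣[F∪Cⱼ]∩N∣≡∣F∩N∣+∣Cⱼ∩N∣ {i} {j} {F} F⊆Cᵢ i≢j v = begin
    ∣ (F ∪ C j) ∩ N G v ∣             ≡⟨ cong ∣_∣ (∩-distribʳ-∪ (N G v) F (C j)) ⟩
    ∣ (F ∩ N G v) ∪ (C j ∩ N G v) ∣   ≡⟨ ∣p∪q∣≡∣p∣+∣q∣ (F ∩ N G v) (C j ∩ N G v) pieces-disjoint ⟩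
    ∣ F ∩ N G v ∣ + ∣ C j ∩ N G v ∣   ∎
    where
    pieces-disjoint : Empty ((F ∩ N G v) ∩ (C j ∩ N G v))
    pieces-disjoint (w , w∈) =
      i≢j (disjoint i j w (F⊆Cᵢ (p∩q⊆p F (N G v) (p∩q⊆p _ _ w∈))) (p∩q⊆p (C j) (N G v) (p∩q⊆q _ _ w∈)))

  fort-lift-∪ : ∀ {i j F} → FortIn G (C i) F → i ≢ j → ∣ F ∩ N G c ∣ ≡ 1 → FortIn G ⊤ (F ∪ C j)
  fort-lift-∪ {i} {j} {F} F-fort@(F⊆Cᵢ , (x , x∈F) , _) i≢j at-cut =
    ⊆⊤ , (x , x∈p∪q⁺ (inj₁ x∈F)) , λ v _ v∉F∪Cⱼ →
      subst (_≢ 1) (sym (∣[F∪Cⱼ]∩N∣≡∣F∩N∣+∣Cⱼ∩N∣ F⊆Cᵢ i≢j v)) (condition v v∉F∪Cⱼ)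
    where
    condition : ∀ v → v ∉ F ∪ C j → ∣ F ∩ N G v ∣ + ∣ C j ∩ N G v ∣ ≢ 1
    condition v v∉F∪Cⱼ with v ≟ c
    ... | yes refl = λ sum≡1 →
      <⇒≢ (cut-sees-component j) (sym (suc-injective (trans (cong (_+ _) (sym at-cut)) sum≡1)))
    ... | no  v≢c  = let m , v∈Cₘ = cover v v≢c in
      subst (_≢ 1) (trans (sym (+-identityʳ _)) (cong (_ +_) (sym (∣∩N∣≡0-across ⊆-refl v∈Cₘ (m≢j v∈Cₘ)))))
        (fort-condition-off-cut F-fort v≢c (v∉F∪Cⱼ ∘ x∈p∪q⁺ ∘ inj₁))
      where
      m≢j : ∀ {m} → v ∈ C m → m ≢ j
      m≢j v∈Cₘ refl = v∉F∪Cⱼ (x∈p∪q⁺ (inj₂ v∈Cₘ))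

  module _ (S : Fin ℓ → Subset n) (S-ZIr : ∀ i → ZIrIn G (C i) (S i)) (j : Fin ℓ) {T : Subset n}
           (T-spec : ∀ v → (v ∈ T) ⇔ (∃ λ i → i ≢ j × v ∈ S i)) where

    T∩F≡Sᵢ∩F : ∀ {i F} → F ⊆ C i → i ≢ j → T ∩ F ≡ S i ∩ F
    T∩F≡Sᵢ∩F {i} {F} F⊆Cᵢ i≢j = ⊆-antisym T∩F⊆Sᵢ∩F Sᵢ∩F⊆T∩F
      where
      T∩F⊆Sᵢ∩F : T ∩ F ⊆ S i ∩ F
      T∩F⊆Sᵢ∩F {w} w∈T∩F with x∈p∩q⁻ T F w∈T∩F
      ... | w∈T , w∈F with Equivalence.to (T-spec w) w∈T
      ...   | m , _ , w∈Sₘ with disjoint m i w (proj₁ (S-ZIr m) w∈Sₘ) (F⊆Cᵢ w∈F)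
      ...     | refl = x∈p∩q⁺ (w∈Sₘ , w∈F)
      Sᵢ∩F⊆T∩F : S i ∩ F ⊆ T ∩ F
      Sᵢ∩F⊆T∩F {w} w∈Sᵢ∩F =
        let w∈Sᵢ , w∈F = x∈p∩q⁻ (S i) F w∈Sᵢ∩F in
        x∈p∩q⁺ (Equivalence.from (T-spec w) (i , i≢j , w∈Sᵢ) , w∈F)

    T∩Cⱼ-empty : Empty (T ∩ C j)
    T∩Cⱼ-empty (w , w∈T∩Cⱼ) =
      let w∈T , w∈Cⱼ = x∈p∩q⁻ T (C j) w∈T∩Cⱼ
          m , m≢j , w∈Sₘ = Equivalence.to (T-spec w) w∈T
      in m≢j (disjoint m j w (proj₁ (S-ZIr m) w∈Sₘ) w∈Cⱼ)

    T∩[F∪Cⱼ]≡T∩F : ∀ F → T ∩ (F ∪ C j) ≡ T ∩ F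
    T∩[F∪Cⱼ]≡T∩F F = begin
      T ∩ (F ∪ C j)        ≡⟨ ∩-distribˡ-∪ T F (C j) ⟩
      T ∩ F ∪ T ∩ C j      ≡⟨ cong (T ∩ F ∪_) (Empty-unique T∩Cⱼ-empty) ⟩
      T ∩ F ∪ ⊥            ≡⟨ ∪-identityʳ (T ∩ F) ⟩
      T ∩ F                ∎

    private-fort : ∀ x → x ∈ T → ∃ λ F → FortIn G ⊤ F × T ∩ F ≡ ⁅ x ⁆
    private-fort x x∈T with Equivalence.to (T-spec x) x∈T
    ... | i , i≢j , x∈Sᵢ with proj₂ (S-ZIr i) x x∈Sᵢ
    ...   | F , F-fort , Sᵢ∩F≡⁅x⁆ with ∣ F ∩ N G c ∣ ℕ.≟ 1
    ...     | no  ≢1 = F , fort-lift F-fort ≢1 , trans (T∩F≡Sᵢ∩F (proj₁ F-fort) i≢j) Sᵢ∩F≡⁅x⁆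
    ...     | yes ≡1 = F ∪ C j , fort-lift-∪ F-fort i≢j ≡1 ,
                       trans (T∩[F∪Cⱼ]≡T∩F F) (trans (T∩F≡Sᵢ∩F (proj₁ F-fort) i≢j) Sᵢ∩F≡⁅x⁆)

union-is-ZIr : ∀ {n ℓ} {G : Graph n} {c} {C : Fin ℓ → Subset n} → ConnectedIn G ⊤ → Components G c C →
               (S : Fin ℓ → Subset n) → (∀ i → ZIrIn G (C i) (S i)) →
               ∀ j (T : Subset n) → (∀ v → (v ∈ T) ⇔ (∃ λ i → i ≢ j × v ∈ S i)) → ZIrIn G ⊤ T
union-is-ZIr G-connected components S S-ZIr j T T-spec =
  ⊆⊤ , CutVertex.private-fort G-connected components S S-ZIr j T-spec

ZIR-lower-bound : ∀ {n k} {G : Graph n} {c} {C : Fin (suc k) → Subset n} {z : Fin (suc k) → ℕ} →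
                  ConnectedIn G ⊤ → Components G c C → (∀ i → IsZIRIn G (C i) (z i)) →
                  ∀ m → IsZIRIn G ⊤ m → sum (map (z ∘ inject₁) (allFin k)) ≤ m
ZIR-lower-bound {n} {k} {G} {C = C} {z} G-connected components ZIR-C m ZIR-G =
  subst (_≤ m) ∣T∣≡sum (∣ZIr∣≤ZIR {G = G} T-ZIr ZIR-G)
  where
  open Components components using (disjoint)

  S : Fin (suc k) → Subset n
  S i = proj₁ (proj₁ (ZIR-C i))

  S-ZIr : ∀ i → ZIrIn G (C i) (S i)
  S-ZIr i = proj₁ (proj₁ (proj₂ (proj₁ (ZIR-C i))))

  T : Subset n
  T = ⋃ (tabulate (S ∘ inject₁))

  T-spec : ∀ v → (v ∈ T) ⇔ (∃ λ i → i ≢ fromℕ k × v ∈ S i)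
  T-spec v = mk⇔ to from
    where
    to : v ∈ T → ∃ λ i → i ≢ fromℕ k × v ∈ S i
    to v∈T = let i , v∈Sᵢ = x∈⋃tabulate⁻ (S ∘ inject₁) v∈T in inject₁ i , fromℕ≢inject₁ ∘ sym , v∈Sᵢ
    from : (∃ λ i → i ≢ fromℕ k × v ∈ S i) → v ∈ T
    from (i , i≢k , v∈Sᵢ) =
      x∈⋃tabulate⁺ (S ∘ inject₁) (lower₁ i k≢i) (subst (λ i → v ∈ S i) (sym (inject₁-lower₁ i k≢i)) v∈Sᵢ)
      where
      k≢i : k ≢ toℕ i
      k≢i k≡i = i≢k (toℕ-injective (trans (sym k≡i) (sym (toℕ-fromℕ k))))

  T-ZIr : ZIrIn G ⊤ T
  T-ZIr = union-is-ZIr G-connected components S S-ZIr (fromℕ k) T T-spec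

  ∣T∣≡sum : ∣ T ∣ ≡ sum (map (z ∘ inject₁) (allFin k))
  ∣T∣≡sum = begin
    ∣ T ∣                                ≡⟨ ∣⋃tabulate∣≡sum (S ∘ inject₁) S-disjoint ⟩
    sum (tabulate (∣_∣ ∘ S ∘ inject₁))   ≡⟨ cong sum (tabulate-cong (proj₂ ∘ proj₂ ∘ proj₁ ∘ ZIR-C ∘ inject₁)) ⟩
    sum (tabulate (z ∘ inject₁))         ≡⟨ cong sum (map-tabulate id (z ∘ inject₁)) ⟨
    sum (map (z ∘ inject₁) (allFin k))   ∎
    where
    S-disjoint : ∀ a b {x} → x ∈ S (inject₁ a) → x ∈ S (inject₁ b) → a ≡ b
    S-disjoint a b x∈Sₐ x∈S_b =
      inject₁-injective (disjoint _ _ _ (proj₁ (S-ZIr _) x∈Sₐ) (proj₁ (S-ZIr _) x∈S_b))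

ZIR-singleton : ∀ {n} (G : Graph n) v → IsZIRIn G ⁅ v ⁆ 1
ZIR-singleton G v =
  (⁅ v ⁆ , (⁅v⁆-ZIr , λ T T-ZIr _ → proj₁ T-ZIr) , ∣⁅x⁆∣≡1 v) ,
  λ S S-maximal → subst (∣ S ∣ ≤_) (∣⁅x⁆∣≡1 v) (p⊆q⇒∣p∣≤∣q∣ (proj₁ (proj₁ S-maximal)))
  where
  ⁅v⁆-ZIr : ZIrIn G ⁅ v ⁆ ⁅ v ⁆
  ⁅v⁆-ZIr = ⊆-refl , λ x x∈⁅v⁆ →
    ⁅ v ⁆ , (⊆-refl , (v , x∈⁅x⁆ v) , λ w w∈⁅v⁆ w∉⁅v⁆ → contradiction w∈⁅v⁆ w∉⁅v⁆) ,
    trans (∩-idem ⁅ v ⁆) (cong ⁅_⁆ (sym (x∈⁅y⁆⇒x≡y v x∈⁅v⁆)))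

star-adj : ∀ {m} → Fin (suc m) → Fin (suc m) → Bool
star-adj zero    zero    = false
star-adj zero    (suc _) = true
star-adj (suc _) zero    = true
star-adj (suc _) (suc _) = false

star : ∀ m → Graph (suc m)
star m = record { adj = star-adj ; sym = symmetric ; irrefl = irreflexive }
  where
  symmetric : ∀ u v → star-adj u v ≡ star-adj v u
  symmetric zero    zero    = refl
  symmetric zero    (suc _) = refl
  symmetric (suc _) zero    = refl
  symmetric (suc _) (suc _) = refl
  irreflexive : ∀ v → star-adj v v ≡ false
  irreflexive zero    = refl
  irreflexive (suc _) = refl

leaf : ∀ {m} → Fin m → Subset (suc m)
leaf i = ⁅ suc i ⁆

star-connected : ∀ m → ConnectedIn (star m) ⊤
star-connected m u v _ _ = to v u
  where
  from-centre : ∀ v → Reach (star m) ⊤ zero v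
  from-centre zero    = here ∈⊤
  from-centre (suc _) = step ∈⊤ refl (here ∈⊤)
  to : ∀ v u → Reach (star m) ⊤ u v
  to v zero    = from-centre v
  to v (suc _) = step ∈⊤ refl (from-centre v)

star-components : ∀ m → Components (star m) zero leaf
star-components m = record
  { avoid     = λ _ ()
  ; cover     = cover
  ; disjoint  = λ i j v v∈leafᵢ v∈leafⱼ → Fin.suc-injective (trans (sym (∈leaf v∈leafᵢ)) (∈leaf v∈leafⱼ))
  ; nonempty  = λ i → suc i , x∈⁅x⁆ (suc i)
  ; connected = connected
  ; noEdges   = no-edges
  }
  where
  ∈leaf : ∀ {i v} → v ∈ leaf {m} i → v ≡ suc i
  ∈leaf = x∈⁅y⁆⇒x≡y _
  cover : ∀ v → v ≢ zero → ∃ λ i → v ∈ leaf i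
  cover zero    v≢0 = contradiction refl v≢0
  cover (suc i) _   = i , x∈⁅x⁆ (suc i)
  connected : ∀ i → ConnectedIn (star m) (leaf i)
  connected i u v u∈leafᵢ v∈leafᵢ with ∈leaf u∈leafᵢ | ∈leaf v∈leafᵢ
  ... | refl | refl = here u∈leafᵢ
  no-edges : ∀ i j u v → u ∈ leaf i → v ∈ leaf j → adj (star m) u v ≡ true → i ≡ j
  no-edges i j u v u∈leafᵢ v∈leafⱼ uv with ∈leaf u∈leafᵢ | ∈leaf v∈leafⱼ
  no-edges i j u v u∈leafᵢ v∈leafⱼ () | refl | refl

leaf-neighbour : ∀ {m} (i : Fin m) {w} → w ∈ N (star m) (suc i) → w ≡ zero
leaf-neighbour i {zero}  _   = refl
leaf-neighbour i {suc _} w∈N = contradiction (∈N⇒adj (star _) (suc i) w∈N) λ ()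

F∩N-centre≡F : ∀ {m} {F : Subset (suc m)} → zero ∉ F → F ∩ N (star m) zero ≡ F
F∩N-centre≡F {m} {F} 0∉F = ⊆-antisym (p∩q⊆p F _) λ {w} w∈F → x∈p∩q⁺ (w∈F , centre-sees w w∈F)
  where
  centre-sees : ∀ w → w ∈ F → w ∈ N (star m) zero
  centre-sees zero    0∈F = contradiction 0∈F 0∉F
  centre-sees (suc _) _   = adj⇒∈N (star m) zero refl

F∩N-leaf≡⁅centre⁆ : ∀ {m} {F : Subset (suc m)} (i : Fin m) → zero ∈ F → F ∩ N (star m) (suc i) ≡ ⁅ zero ⁆
F∩N-leaf≡⁅centre⁆ {m} {F} i 0∈F = ⊆-antisym
  (λ w∈F∩N → Equivalence.from x∈⁅y⁆⇔x≡y (leaf-neighbour i (p∩q⊆q F _ w∈F∩N)))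
  (λ w∈⁅0⁆ → subst (_∈ F ∩ N (star m) (suc i)) (sym (x∈⁅y⁆⇒x≡y zero w∈⁅0⁆))
                   (x∈p∩q⁺ (0∈F , adj⇒∈N (star m) (suc i) refl)))

star-fort-∋centre⇒⊤ : ∀ {m F} → FortIn (star m) ⊤ F → zero ∈ F → F ≡ ⊤
star-fort-∋centre⇒⊤ {m} {F} (_ , _ , fort) 0∈F = ⊆-antisym ⊆⊤ λ {v} _ → decidable-stable (v ∈? F) (∈F v)
  where
  ∈F : ∀ v → ¬ v ∉ F
  ∈F zero    0∉F = 0∉F 0∈F
  ∈F (suc i) v∉F = fort (suc i) ∈⊤ v∉F (trans (cong ∣_∣ (F∩N-leaf≡⁅centre⁆ i 0∈F)) (∣⁅x⁆∣≡1 {suc m} zero))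

star-fort-∌centre⇒∣F∣≢1 : ∀ {m F} → FortIn (star m) ⊤ F → zero ∉ F → ∣ F ∣ ≢ 1
star-fort-∌centre⇒∣F∣≢1 (_ , _ , fort) 0∉F = subst (_≢ 1) (cong ∣_∣ (F∩N-centre≡F 0∉F)) (fort zero ∈⊤ 0∉F)

star-fort⁺ : ∀ {m F} → Nonempty F → zero ∉ F → ∣ F ∣ ≢ 1 → FortIn (star m) ⊤ F
star-fort⁺ {m} {F} F-nonempty 0∉F ∣F∣≢1 = ⊆⊤ , F-nonempty , condition
  where
  condition : ∀ v → v ∈ ⊤ → v ∉ F → ∣ F ∩ N (star m) v ∣ ≢ 1
  condition zero    _ _ = subst (_≢ 1) (sym (cong ∣_∣ (F∩N-centre≡F 0∉F))) ∣F∣≢1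
  condition (suc i) _ _ = subst (_≢ 1) (sym (Empty⇒∣p∣≡0 F∩N-empty)) λ ()
    where
    F∩N-empty : Empty (F ∩ N (star m) (suc i))
    F∩N-empty (w , w∈F∩N) =
      let w∈F , w∈N = x∈p∩q⁻ F _ w∈F∩N in 0∉F (subst (_∈ F) (leaf-neighbour i w∈N) w∈F)

all-leaves-not-ZIr : ∀ {k} → ¬ ZIrIn (star (2 + k)) ⊤ (outside ∷ ⊤)
all-leaves-not-ZIr {k} (_ , private-fort) with private-fort (suc zero) (there ∈⊤)
... | F , F-fort , L∩F≡⁅1⁆ with zero ∈? F
...   | yes 0∈F = contradiction (x∈⁅y⁆⇒x≡y (suc zero) (subst (suc (suc zero) ∈_) L≡⁅1⁆ (there ∈⊤))) λ ()
  where
  L≡⁅1⁆ : outside ∷ ⊤ ≡ ⁅ suc zero ⁆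
  L≡⁅1⁆ = trans (sym (∩-identityʳ _))
                (subst (λ F → (outside ∷ ⊤) ∩ F ≡ _) (star-fort-∋centre⇒⊤ F-fort 0∈F) L∩F≡⁅1⁆)
...   | no  0∉F = star-fort-∌centre⇒∣F∣≢1 F-fort 0∉F (trans (cong ∣_∣ F≡⁅1⁆) (∣⁅x⁆∣≡1 {3 + k} (suc zero)))
  where
  F⊆L : F ⊆ outside ∷ ⊤
  F⊆L {zero}  0∈F = contradiction 0∈F 0∉F
  F⊆L {suc _} _   = there ∈⊤
  F≡⁅1⁆ : F ≡ ⁅ suc zero ⁆
  F≡⁅1⁆ = trans (⊆-antisym (λ w∈F → x∈p∩q⁺ (F⊆L w∈F , w∈F)) (p∩q⊆q _ F)) L∩F≡⁅1⁆

star-ZIr-bound : ∀ {k S} → ZIrIn (star (2 + k)) ⊤ S → ∣ S ∣ ≤ suc k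
star-ZIr-bound {k} {inside ∷ S} (_ , private-fort) with private-fort zero here
... | F , F-fort , S∩F≡⁅0⁆ = subst (_≤ suc k) (sym ∣S∣≡1) (s≤s z≤n)
  where
  0∈F : zero ∈ F
  0∈F = p∩q⊆q (inside ∷ S) F (subst (zero ∈_) (sym S∩F≡⁅0⁆) (x∈⁅x⁆ zero))
  S≡⁅0⁆ : inside ∷ S ≡ ⁅ zero ⁆
  S≡⁅0⁆ = trans (sym (∩-identityʳ _))
                (subst (λ F → (inside ∷ S) ∩ F ≡ _) (star-fort-∋centre⇒⊤ F-fort 0∈F) S∩F≡⁅0⁆)
  ∣S∣≡1 : ∣ inside ∷ S ∣ ≡ 1
  ∣S∣≡1 = trans (cong ∣_∣ S≡⁅0⁆) (∣⁅x⁆∣≡1 {3 + k} zero)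
star-ZIr-bound {k} {outside ∷ S} S-ZIr = ≤-pred (≤∧≢⇒< (∣p∣≤n S) S-not-all-leaves)
  where
  S-not-all-leaves : ∣ S ∣ ≢ 2 + k
  S-not-all-leaves ∣S∣≡2+k =
    all-leaves-not-ZIr (subst (λ S → ZIrIn (star (2 + k)) ⊤ (outside ∷ S)) (∣p∣≡n⇒p≡⊤ ∣S∣≡2+k) S-ZIr)

all-leaves-but-one-ZIr : ∀ {k} → ZIrIn (star (2 + k)) ⊤ (outside ∷ outside ∷ ⊤)
all-leaves-but-one-ZIr {k} = ⊆⊤ , private-fort
  where
  private-fort : ∀ x → x ∈ outside ∷ outside ∷ ⊤ →
                 ∃ λ F → FortIn (star (2 + k)) ⊤ F × (outside ∷ outside ∷ ⊤) ∩ F ≡ ⁅ x ⁆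
  private-fort zero          ()
  private-fort (suc zero)    (there ())
  private-fort (suc (suc i)) _ =
    outside ∷ inside ∷ ⁅ i ⁆ ,
    star-fort⁺ (suc zero , there here) (λ ())
               (λ ∣F∣≡1 → contradiction (trans (sym (∣⁅x⁆∣≡1 i)) (suc-injective ∣F∣≡1)) λ ()) ,
    cong (λ p → outside ∷ outside ∷ p) (∩-identityˡ ⁅ i ⁆)

star-ZIR : ∀ k → IsZIRIn (star (2 + k)) ⊤ (suc k)
star-ZIR k =
  (outside ∷ outside ∷ ⊤ , (all-leaves-but-one-ZIr , maximal) , ∣⊤∣≡n (suc k)) ,
  λ S S-maximal → star-ZIr-bound (proj₁ S-maximal)
  where
  maximal : ∀ T → ZIrIn (star (2 + k)) ⊤ T → outside ∷ outside ∷ ⊤ ⊆ T → T ⊆ outside ∷ outside ∷ ⊤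
  maximal T T-ZIr ⊆T = p⊆q⇒∣q∣≤∣p∣⇒q⊆p ⊆T (subst (∣ T ∣ ≤_) (sym (∣⊤∣≡n (suc k))) (star-ZIr-bound T-ZIr))

-- ℓ = suc k components, ℓ ≥ 3 ⇔ 2 ≤ k; the last component (index k) is the one dropped in the sum
proposition6p1 :
    (∀ {n} (G : Graph n) (c : Fin n) (k : ℕ) (C : Fin (suc k) → Subset n) (z : Fin (suc k) → ℕ) →
      2 ≤ k → ConnectedIn G ⊤ → Components G c C →
      (∀ i → IsZIRIn G (C i) (z i)) → (∀ i j → i ≤ᶠ j → z j ≤ z i) →
      ((S : Fin (suc k) → Subset n) → (∀ i → ZIrIn G (C i) (S i)) →
        ∀ j (T : Subset n) → (∀ v → (v ∈ T) ⇔ (∃ λ i → i ≢ j × v ∈ S i)) → ZIrIn G ⊤ T)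
      × (∀ m → IsZIRIn G ⊤ m → sum (map (λ i → z (inject₁ i)) (allFin k)) ≤ m))
    × (∃ λ n → Σ (Graph n) λ G → Σ (Fin n) λ c → Σ ℕ λ k → Σ (Fin (suc k) → Subset n) λ C →
        Σ (Fin (suc k) → ℕ) λ z →
        2 ≤ k × ConnectedIn G ⊤ × Components G c C ×
        (∀ i → IsZIRIn G (C i) (z i)) × (∀ i j → i ≤ᶠ j → z j ≤ z i) ×
        IsZIRIn G ⊤ (sum (map (λ i → z (inject₁ i)) (allFin k))))
proposition6p1 =
  (λ G c k C z _ G-connected components ZIR-C _ →
     union-is-ZIr G-connected components , ZIR-lower-bound G-connected components ZIR-C) ,
  (4 , star 3 , zero , 2 , leaf , (λ _ → 1) , s≤s (s≤s z≤n) , star-connected 3 , star-components 3 ,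
   (λ i → ZIR-singleton (star 3) (suc i)) , (λ _ _ _ → ≤-refl) , star-ZIR 1)
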